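{- Let $p$ be a prime, $s,N\in\mathbb N$, $K=GF(p^s)$, let $T$ be an $N$-valid tree, let $\tilde T$ be the associated tree and $C(\cdot)$ the associated successor sets (as defined in the context), and let $\lambda=(\lambda_{i_1,\dots,i_{N+1}})_{i_1,\dots,i_{N+1}\in K}$ be an admissible array of nonnegative reals for $T$. Define $a^{(0)}_{i_1,\dots,i_N}=\lambda_{i_1,i_2,\dots,i_N,0}\,\lambda_{i_2,\dots,i_N,0,0}\cdots\lambda_{i_N,0,\dots,0}$ for $(i_1,\dots,i_N)\in K^N$. Then $a^{(0)}_{b}=1$ for every vertex $b\in K^N$ of $\tilde T$ whose level in $\tilde T$ is at most $N$.
   Context: $0$ denotes the zero element of $K=GF(p^s)$. The level of a vertex of a rooted tree is its distance to the root; the height is the maximal level. An $N$-valid tree $T$ is a finite rooted tree whose edges are oriented from the leaves toward the root (each non-root vertex points to its parent), each vertex carrying a label in $K$, such that: (i) the root and all vertices of levels $1,\dots,N-1$ have label $0$; (ii) every sequence $(c_1,\dots,c_N)\in K^N$ occurs exactly once as the sequence of labels of a directed path $v_1\to v_2\to\dots\to v_N$ in $T$ (each $v_{j+1}$ the parent of $v_j$). The tree $\tilde T$: its vertices are the $N$-tuples $(c_1,\dots,c_N)$ of labels of such paths (by (ii) these are exactly all elements of $K^N$, each once); if $v_1$ has level $L\ (\ge N-1)$ in $T$, the vertex $(c_1,\dots,c_N)$ has level $L-N+1$ in $\tilde T$, and for $L\ge N$ its parent in $\tilde T$ is the tuple $(c_2,\dots,c_N,c_{N+1})$ of labels of the path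 $v_2\to\dots\to v_{N+1}$, $v_{N+1}$ the parent of $v_N$. The root of $\tilde T$ is $(0,\dots,0)$. For a vertex $b=(b_1,\dots,b_N)$ of $\tilde T$ of level $l\ge1$, let $C(b)$ be the set of $c\in K$ such that $(b_2,\dots,b_N,c)$ is a vertex of $\tilde T$ of level strictly less than $l$ (i.e. the directed graph $\Gamma$ joins $b$ to all such vertices); for the root set $C(0,\dots,0)=\{0\}$. The array $\lambda$ is admissible if $\lambda_{0,\dots,0}=1$ and for every $b\in K^N$: $\sum_{c\in C(b)}\lambda_{b_1,\dots,b_N,c}=1$ and $\lambda_{b_1,\dots,b_N,c}=0$ for all $c\notin C(b)$. -}

module Defs where

open import Level using (Level; _⊔_)
open import Data.Nat using (ℕ; zero; suc; _∸_; _≤_; _<_; _≡ᵇ_; _<ᵇ_)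
open import Data.Nat.Properties using ()
open import Data.Fin using (Fin; toℕ)
open import Data.Bool using (Bool; true; false; if_then_else_)
open import Data.Maybe using (Maybe; just; nothing)
open import Data.Vec using (Vec; []; _∷_; _∷ʳ_; tabulate; replicate)
open import Data.Product using (Σ; _×_; _,_; proj₁)
open import Relation.Binary.PropositionalEquality using (_≡_)
open import Relation.Binary using (Rel; DecidableEquality)
open import Relation.Nullary.Decidable using (⌊_⌋)
open import Algebra.Bundles using (CommutativeSemiring)

-- The field K = GF(p^s) enters only through its underlying finite set and
-- its zero element.  We model K as Fin (suc k) (with suc k = p^s) and the
-- zero element of K as the element 'zero' of Fin (suc k).
𝕂 : ℕ → Set
𝕂 k = Fin (suc k)

0𝕂 : {k : ℕ} → 𝕂 k
0𝕂 = Fin.zero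
  where import Data.Fin as Fin

record RootedTree : Set where
  field
    size           : ℕ
    root           : Fin size
    parent         : Fin size → Maybe (Fin size)
    level          : Fin size → ℕ
    root-noparent  : parent root ≡ nothing
    only-root      : ∀ v → parent v ≡ nothing → v ≡ root
    level-root     : level root ≡ 0
    level-parent   : ∀ v w → parent v ≡ just w → level v ≡ suc (level w)

  up : Fin size → Fin size
  up v with parent v
  ... | just w  = w
  ... | nothing = v

  anc : ℕ → Fin size → Fin size
  anc zero    v = v
  anc (suc j) v = anc j (up v)

record LabelledTree (k : ℕ) : Set where
  field
    tree  : RootedTree
  open RootedTree tree public
  field
    label : Fin size → 𝕂 k

  -- For a vertex v₁ of level ≥ N-1, the labels (c₁,…,c_N) of the directed
  -- path v₁ → v₂ → … → v_N (v_{j+1} the parent of v_j).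
  word : (N : ℕ) → Fin size → Vec (𝕂 k) N
  word N v = tabulate (λ j → label (anc (toℕ j) v))

module _ {k : ℕ} (T : LabelledTree k) (N : ℕ) where
  open LabelledTree T
  PathWith : Vec (𝕂 k) N → Fin size → Set
  PathWith c v = (N ∸ 1 ≤ level v) × (word N v ≡ c)

record ValidTree (k N : ℕ) : Set where
  field
    ltree : LabelledTree k
  open LabelledTree ltree public
  field
    low-zero : ∀ v → level v < N → label v ≡ 0𝕂
    unique-path : ∀ (c : Vec (𝕂 k) N) →
      Σ (Fin size) λ v → PathWith ltree N c v ×
        (∀ w → PathWith ltree N c w → w ≡ v)

  start : Vec (𝕂 k) N → Fin size
  start c = proj₁ (unique-path c)

  -- level of the vertex c of the associated tree T̃  (L - N + 1)
  tlevel : Vec (𝕂 k) N → ℕ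
  tlevel c = level (start c) ∸ (N ∸ 1)

shiftIn : {A : Set} {n : ℕ} → Vec A n → A → Vec A n
shiftIn []       c = []
shiftIn (_ ∷ bs) c = bs ∷ʳ c

module _ {k N : ℕ} (T : ValidTree k N) where
  open ValidTree T

  inC : Vec (𝕂 k) N → 𝕂 k → Bool
  inC b c with tlevel b
  ... | zero  = toℕ c ≡ᵇ 0
  ... | suc l = tlevel (shiftIn b c) <ᵇ suc l

module _ {c ℓ : Level} (R : CommutativeSemiring c ℓ) where
  open CommutativeSemiring R

  sumFin : (n : ℕ) → (Fin n → Carrier) → Carrier
  sumFin zero    f = 0#
  sumFin (suc n) f = f Fin.zero + sumFin n (λ i → f (Fin.suc i))
    where import Data.Fin as Fin

  prodUpTo : ℕ → (ℕ → Carrier) → Carrier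
  prodUpTo zero    f = 1#
  prodUpTo (suc n) f = f 0 * prodUpTo n (λ j → f (suc j))

  module _ {k N : ℕ} (T : ValidTree k N) where

    Admissible : (Vec (𝕂 k) (suc N) → Carrier) → Set ℓ
    Admissible lam =
      (lam (replicate (suc N) 0𝕂) ≈ 1#) ×
      (∀ (b : Vec (𝕂 k) N) →
         (sumFin (suc k) (λ c → if inC T b c then lam (b ∷ʳ c) else 0#) ≈ 1#) ×
         (∀ c → inC T b c ≡ false → lam (b ∷ʳ c) ≈ 0#))

  shiftZ : {k n : ℕ} → ℕ → Vec (𝕂 k) n → Vec (𝕂 k) n
  shiftZ zero    b = b
  shiftZ (suc j) b = shiftZ j (shiftIn b 0𝕂)

  a0 : {k N : ℕ} → (Vec (𝕂 k) (suc N) → Carrier) → Vec (𝕂 k) N → Carrier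
  a0 {k} {N} lam i = prodUpTo N (λ j → lam (shiftZ j i ∷ʳ 0𝕂))

{-# OPTIONS --safe #-}
module Submission where

open import Defs
open import Level using (Level)
open import Function using (_∘_; const; Equivalence)
open import Data.Nat using (ℕ; zero; suc; _+_; _∸_; _^_; _≤_; _<_; _≡ᵇ_; _<ᵇ_; z≤n; s≤s)
open import Data.Nat.Primality using (Prime)
open import Data.Nat.Properties
  using (≤-trans; m∸n≤m; m∸n≡0⇒m≤n; m∸n+n≡m; m+n∸n≡m; m≤n+m; n≤1+n; n<1+n; ∸-+-assoc; <⇒<ᵇ; <ᵇ⇒<)
open import Data.Fin using (Fin; toℕ) renaming (zero to fzero; suc to fsuc)
open import Data.Bool using (true; false; if_then_else_)
open import Data.Bool.Properties using (T-≡)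
open import Data.Maybe using (just; nothing)
open import Data.Vec using (Vec; _∷_; _∷ʳ_; tabulate; last)
open import Data.Vec.Properties using (tabulate-cong; last-∷ʳ)
open import Data.Product using (_,_; proj₁; proj₂)
open import Relation.Binary using (Rel)
open import Relation.Binary.PropositionalEquality
  using (_≡_; refl; sym; trans; cong; subst; module ≡-Reasoning)
open import Algebra.Bundles using (CommutativeSemiring)

-- The last entry of a vertex c of T̃ is the label of a vertex of T of level tlevel c, so it is 0
-- as soon as tlevel c < N.  Hence for a vertex b of level 1 ≤ l ≤ N a shift (b₂,…,b_N,c) of
-- level < l must have c = 0, while the parent of b is (b₂,…,b_N,0), of level l − 1; at the root
-- C = {0} by definition.  So C(b) = {0} whenever tlevel b ≤ N, admissibility forces λ_{b,0} = 1,
-- and since shifting in 0 keeps the level ≤ N, every factor of a⁽⁰⁾_b equals 1.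

tabulate-∷ʳ : ∀ {A : Set} n (g : ℕ → A) →
  tabulate {n = n} (g ∘ toℕ) ∷ʳ g n ≡ tabulate {n = suc n} (g ∘ toℕ)
tabulate-∷ʳ zero    g = refl
tabulate-∷ʳ (suc n) g = cong (g 0 ∷_) (tabulate-∷ʳ n (g ∘ suc))

shiftIn-tabulate : ∀ {A : Set} n (g : ℕ → A) →
  shiftIn (tabulate {n = n} (g ∘ toℕ)) (g n) ≡ tabulate {n = n} (g ∘ suc ∘ toℕ)
shiftIn-tabulate zero    g = refl
shiftIn-tabulate (suc n) g = tabulate-∷ʳ n (g ∘ suc)

last-shiftIn : ∀ {A : Set} {n} (xs : Vec A (suc n)) x → last (shiftIn xs x) ≡ x
last-shiftIn (_ ∷ ys) x = last-∷ʳ x ys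

last-tabulate : ∀ {A : Set} n (g : ℕ → A) → last (tabulate {n = suc n} (g ∘ toℕ)) ≡ g n
last-tabulate n g = trans (cong last (sym (tabulate-∷ʳ n g))) (last-∷ʳ (g n) (tabulate {n = n} (g ∘ toℕ)))

module _ (t : RootedTree) where
  open RootedTree t

  level-up : ∀ v → level (up v) ≡ level v ∸ 1
  level-up v with parent v in eq
  ... | just w  = cong (_∸ 1) (sym (level-parent v w eq))
  ... | nothing rewrite only-root v eq | level-root = refl

  level-anc : ∀ j v → level (anc j v) ≡ level v ∸ j
  level-anc zero    v = refl
  level-anc (suc j) v = begin
    level (anc j (up v))  ≡⟨ level-anc j (up v) ⟩
    level (up v) ∸ j      ≡⟨ cong (_∸ j) (level-up v) ⟩
    level v ∸ 1 ∸ j       ≡⟨ ∸-+-assoc (level v) 1 j ⟩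
    level v ∸ suc j       ∎
    where open ≡-Reasoning

module ValidTreeLevels {k n : ℕ} (T : ValidTree k (suc n)) where
  open ValidTree T

  start-path : ∀ c → PathWith ltree (suc n) c (start c)
  start-path c = proj₁ (proj₂ (unique-path c))

  start-unique : ∀ c w → PathWith ltree (suc n) c w → w ≡ start c
  start-unique c = proj₂ (proj₂ (unique-path c))

  last≡label-anc : ∀ c → last c ≡ label (anc n (start c))
  last≡label-anc c =
    trans (cong last (sym (proj₂ (start-path c)))) (last-tabulate n (λ j → label (anc j (start c))))

  last≡0 : ∀ c → tlevel c < suc n → last c ≡ 0𝕂
  last≡0 c low = trans (last≡label-anc c) (low-zero _ (subst (_< suc n) (sym level≡tlevel) low))
    where
    level≡tlevel : level (anc n (start c)) ≡ tlevel c
    level≡tlevel = level-anc tree n (start c)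

  shiftIn-low⇒0 : ∀ b c → tlevel (shiftIn b c) < suc n → c ≡ 0𝕂
  shiftIn-low⇒0 b c low = trans (sym (last-shiftIn b c)) (last≡0 (shiftIn b c) low)

  tlevel≡0⇒zeros : ∀ b → tlevel b ≡ 0 → b ≡ tabulate (const 0𝕂)
  tlevel≡0⇒zeros b root = trans (sym (proj₂ (start-path b))) (tabulate-cong label≡0)
    where
    label≡0 : ∀ j → label (anc (toℕ j) (start b)) ≡ 0𝕂
    label≡0 j = low-zero _ (subst (_< suc n) (sym (level-anc tree (toℕ j) (start b)))
                  (s≤s (≤-trans (m∸n≤m _ (toℕ j)) (m∸n≡0⇒m≤n root))))

  shiftIn-root : ∀ b → tlevel b ≡ 0 → shiftIn b 0𝕂 ≡ b
  shiftIn-root b root = begin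
    shiftIn b 0𝕂                    ≡⟨ cong (λ x → shiftIn x 0𝕂) b≡zeros ⟩
    shiftIn (tabulate (const 0𝕂)) 0𝕂 ≡⟨ shiftIn-tabulate (suc n) (const 0𝕂) ⟩
    tabulate (const 0𝕂)             ≡⟨ sym b≡zeros ⟩
    b                               ∎
    where
    open ≡-Reasoning
    b≡zeros = tlevel≡0⇒zeros b root

  module _ (b : Vec (𝕂 k) (suc n)) (l : ℕ) (b-level : tlevel b ≡ suc l) where
    private
      v = start b

    level-start : level v ≡ suc l + n
    level-start = trans (sym (m∸n+n≡m (proj₁ (start-path b)))) (cong (_+ n) b-level)

    level-parent-label : level (anc (suc n) v) ≡ l
    level-parent-label = trans (level-anc tree (suc n) v) (trans (cong (_∸ suc n) level-start) (m+n∸n≡m l n))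

    level-up-start : level (up v) ≡ l + n
    level-up-start = trans (level-up tree v) (cong (_∸ 1) level-start)

    up-path : PathWith ltree (suc n) (shiftIn b (label (anc (suc n) v))) (up v)
    up-path = subst (n ≤_) (sym level-up-start) (m≤n+m n l)
            , trans (sym (shiftIn-tabulate (suc n) (λ j → label (anc j v))))
                    (cong (λ x → shiftIn x (label (anc (suc n) v))) (proj₂ (start-path b)))

    tlevel-parent : tlevel (shiftIn b (label (anc (suc n) v))) ≡ l
    tlevel-parent = begin
      level (start (shiftIn b (label (anc (suc n) v)))) ∸ n ≡⟨ cong (λ w → level w ∸ n) (sym (start-unique _ (up v) up-path)) ⟩
      level (up v) ∸ n                                     ≡⟨ cong (_∸ n) level-up-start ⟩
      l + n ∸ n                                            ≡⟨ m+n∸n≡m l n ⟩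
      l                                                    ∎
      where open ≡-Reasoning

    tlevel-shiftIn-0 : l < suc n → tlevel (shiftIn b 0𝕂) ≡ l
    tlevel-shiftIn-0 l<N = subst (λ x → tlevel (shiftIn b x) ≡ l) parent-label≡0 tlevel-parent
      where
      parent-label≡0 : label (anc (suc n) v) ≡ 0𝕂
      parent-label≡0 = low-zero _ (subst (_< suc n) (sym level-parent-label) l<N)

  inC-low : ∀ b → tlevel b ≤ suc n → ∀ c → inC T b c ≡ (toℕ c ≡ᵇ 0)
  inC-low b low c with tlevel b in b-level
  ... | zero  = refl
  ... | suc l = inC-suc c
    where
    inC-suc : ∀ c → (tlevel (shiftIn b c) <ᵇ suc l) ≡ (toℕ c ≡ᵇ 0)
    inC-suc fzero rewrite tlevel-shiftIn-0 b l b-level low = Equivalence.to T-≡ (<⇒<ᵇ (n<1+n l))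
    inC-suc (fsuc i) with tlevel (shiftIn b (fsuc i)) <ᵇ suc l in lt
    ... | false = refl
    ... | true with () ← shiftIn-low⇒0 b (fsuc i) (≤-trans (<ᵇ⇒< _ _ (Equivalence.from T-≡ lt)) low)

  shiftIn-0-low : ∀ b → tlevel b ≤ suc n → tlevel (shiftIn b 0𝕂) ≤ suc n
  shiftIn-0-low b low with tlevel b in b-level
  ... | zero  = subst (_≤ suc n) (sym (trans (cong tlevel (shiftIn-root b b-level)) b-level)) z≤n
  ... | suc l = subst (_≤ suc n) (sym (tlevel-shiftIn-0 b l b-level low)) (≤-trans (n≤1+n l) low)

module _ {c ℓ : Level} (R : CommutativeSemiring c ℓ) where
  open CommutativeSemiring R
    using (Carrier; _≈_; 0#; 1#; setoid; reflexive; +-cong; +-congˡ; +-identityˡ; +-identityʳ; *-cong; *-identityˡ)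
    renaming (refl to ≈-refl; trans to ≈-trans)

  sumFin-zero : ∀ m (f : Fin m → Carrier) → (∀ i → f i ≈ 0#) → sumFin R m f ≈ 0#
  sumFin-zero zero    f f≈0 = ≈-refl
  sumFin-zero (suc m) f f≈0 =
    ≈-trans (+-cong (f≈0 fzero) (sumFin-zero m (f ∘ fsuc) (f≈0 ∘ fsuc))) (+-identityˡ 0#)

  sumFin-head : ∀ m (f : Fin (suc m) → Carrier) → (∀ i → f (fsuc i) ≈ 0#) → sumFin R (suc m) f ≈ f fzero
  sumFin-head m f tail≈0 = ≈-trans (+-congˡ (sumFin-zero m (f ∘ fsuc) tail≈0)) (+-identityʳ (f fzero))

  module _ {k n : ℕ} (T : ValidTree k (suc n)) (lam : Vec (𝕂 k) (suc (suc n)) → Carrier)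
           (adm : Admissible R T lam) where
    open ValidTree T using (tlevel)
    open ValidTreeLevels T using (inC-low; shiftIn-0-low)

    lam-∷ʳ0≈1 : ∀ b → tlevel b ≤ suc n → lam (b ∷ʳ 0𝕂) ≈ 1#
    lam-∷ʳ0≈1 b low = begin
      lam (b ∷ʳ 0𝕂)               ≡⟨ cong (if_then lam (b ∷ʳ 0𝕂) else 0#) (sym (inC-low b low fzero)) ⟩
      restricted fzero           ≈⟨ sumFin-head k restricted restricted-tail≈0 ⟨
      sumFin R (suc k) restricted ≈⟨ proj₁ (proj₂ adm b) ⟩
      1#                          ∎
      where
      open import Relation.Binary.Reasoning.Setoid setoid
      restricted : 𝕂 k → Carrier
      restricted c = if inC T b c then lam (b ∷ʳ c) else 0#
      restricted-tail≈0 : ∀ i → restricted (fsuc i) ≈ 0#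
      restricted-tail≈0 i = reflexive (cong (if_then lam (b ∷ʳ fsuc i) else 0#) (inC-low b low (fsuc i)))

    prodUpTo-shiftZ≈1 : ∀ m b → tlevel b ≤ suc n → prodUpTo R m (λ j → lam (shiftZ R j b ∷ʳ 0𝕂)) ≈ 1#
    prodUpTo-shiftZ≈1 zero    b low = ≈-refl
    prodUpTo-shiftZ≈1 (suc m) b low = ≈-trans
      (*-cong (lam-∷ʳ0≈1 b low) (prodUpTo-shiftZ≈1 m (shiftIn b 0𝕂) (shiftIn-0-low b low)))
      (*-identityˡ 1#)

lemma4p1 : ∀ {c ℓ ℓ′ : Level} (R : CommutativeSemiring c ℓ)
    (_≤R_ : Rel (CommutativeSemiring.Carrier R) ℓ′)
    (p : ℕ) → Prime p → (s k N : ℕ) → suc k ≡ p ^ s →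
    (T : ValidTree k N) →
    (lam : Vec (𝕂 k) (suc N) → CommutativeSemiring.Carrier R) →
    (∀ i → CommutativeSemiring.0# R ≤R lam i) →
    Admissible R T lam →
    ∀ (b : Vec (𝕂 k) N) → ValidTree.tlevel T b ≤ N →
    CommutativeSemiring._≈_ R (a0 R lam b) (CommutativeSemiring.1# R)
lemma4p1 R _ _ _ _ _ zero    _ _ _   _ _   _ _   = CommutativeSemiring.refl R
lemma4p1 R _ _ _ _ _ (suc n) _ T lam _ adm b low = prodUpTo-shiftZ≈1 R T lam adm (suc n) b low
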